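{- Let $\alpha\in\mathfrak S_a$, $\beta\in\mathfrak S_b$ and $\pi=12[\alpha,\beta]$. The map $\eta$ is a bijection from $U_{\alpha,\beta}$ onto $R(\pi)$, and the graph $G_{\alpha,\beta}$ is isomorphic to $G_{\pi}$.
   Context: For $\pi\in\mathfrak S_n$, $R(\pi)$ is the set of reduced words (minimal-length words $r_1\cdots r_\ell$ in $[n-1]$ with $\pi=s_{r_1}\cdots s_{r_\ell}$, $s_i=(i,i+1)$), and $G_\pi$ is the graph on $R(\pi)$ whose edges join words related by one commutation move (exchange adjacent $jk$, $|j-k|>1$) or one long braid move (consecutive $j(j+1)j\leftrightarrow(j+1)j(j+1)$). $12[\alpha,\beta]=\alpha_1\cdots\alpha_a(\beta_1+a)\cdots(\beta_b+a)$. Let $\underline{R}(\alpha)$ be the set of reduced words of $\alpha$ written in the formal alphabet $\{\underline1,\dots,\underline{a-1}\}$ and $\overline{R}(\beta)$ the reduced words of $\beta$ in the disjoint formal alphabet $\{\overline1,\dots,\overline{b-1}\}$. A shuffle of words $u$ and $v$ is a word of length $|u|+|v|$ whose letters can be partitioned into a subsequence equal to $u$ and a complementary subsequence equal to $v$. $U_{\alpha,\beta}$ is the set of all shuffles of some $u\in\underline R(\alpha)$ with some $v\in\overline R(\beta)$. $G_{\alpha,\beta}$ is the graph on $U_{\alpha,\beta}$ with edges joining words obtained from each other by: exchanging adjacent letters $\underline{j}\,\underline{k}$ with $|j-k|>1$; exchanging adjacent $\overline{j}\,\overline{k}$ with $|j-k|>1$; exchanging adjacent $\underline j\,\overline k$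 (or $\overline k\,\underline j$) for any $j,k$; replacing consecutive $\underline j\,\underline{j+1}\,\underline j$ by $\underline{j+1}\,\underline j\,\underline{j+1}$ or vice versa; replacing consecutive $\overline j\,\overline{j+1}\,\overline j$ by $\overline{j+1}\,\overline j\,\overline{j+1}$ or vice versa. The map $\eta$ sends $w=w_1\cdots w_k\in U_{\alpha,\beta}$ to $r=r_1\cdots r_k$ where $r_i=j$ if $w_i=\underline j$ and $r_i=j+a$ if $w_i=\overline j$. -}

module Defs where

open import Data.Nat using (ℕ; zero; suc; _+_; _∸_; _≤_; _<_; ∣_-_∣)
open import Data.Nat.Properties using (_<?_; _≟_)
open import Data.Fin using (Fin; toℕ; fromℕ<)
open import Data.Fin.Permutation using (Permutation′; _⟨$⟩ʳ_)
open import Data.List using (List; []; _∷_; _++_; length; map)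
open import Data.List.Relation.Unary.All using (All)
open import Data.Product using (Σ; ∃; _×_; _,_; proj₁)
open import Relation.Binary.PropositionalEquality using (_≡_)
open import Relation.Nullary using (yes; no; ¬_)

-- the stdlib permutation α ∈ 𝔖_a, as a function on ℕ which is α on
-- {1..a} (1-indexed) and the identity elsewhere
toFun : {a : ℕ} → Permutation′ a → ℕ → ℕ
toFun {a} α zero = zero
toFun {a} α (suc k) with k <? a
... | yes p = suc (toℕ (α ⟨$⟩ʳ fromℕ< p))
... | no _  = suc k

oplus12 : {a b : ℕ} → Permutation′ a → Permutation′ b → ℕ → ℕ
oplus12 {a} α β i with a <? i
... | yes _ = toFun β (i ∸ a) + a
... | no _  = toFun α i

s : ℕ → ℕ → ℕ
s r i with i ≟ r
... | yes _ = suc r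
... | no _ with i ≟ suc r
...   | yes _ = r
...   | no _  = i

prod : List ℕ → ℕ → ℕ
prod []      = λ i → i
prod (r ∷ w) = λ i → s r (prod w i)

IsWordFor : ℕ → (ℕ → ℕ) → List ℕ → Set
IsWordFor n f w =
  All (λ r → 1 ≤ r × r < n) w × (∀ i → 1 ≤ i → i ≤ n → prod w i ≡ f i)

Reduced : ℕ → (ℕ → ℕ) → List ℕ → Set
Reduced n f w = IsWordFor n f w × (∀ w′ → IsWordFor n f w′ → length w ≤ length w′)

data NatMove : List ℕ → List ℕ → Set where
  comm  : ∀ j k → 1 < ∣ j - k ∣ → NatMove (j ∷ k ∷ []) (k ∷ j ∷ [])
  braid : ∀ j → NatMove (j ∷ suc j ∷ j ∷ []) (suc j ∷ j ∷ suc j ∷ [])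
  braid′ : ∀ j → NatMove (suc j ∷ j ∷ suc j ∷ []) (j ∷ suc j ∷ j ∷ [])

Step : {A : Set} → (List A → List A → Set) → List A → List A → Set
Step {A} M w w′ = Σ (List A) λ x → Σ (List A) λ y → Σ (List A) λ l → Σ (List A) λ l′ →
  M l l′ × w ≡ x ++ l ++ y × w′ ≡ x ++ l′ ++ y

NatAdj : List ℕ → List ℕ → Set
NatAdj = Step NatMove

data Letter : Set where
  under : ℕ → Letter
  over  : ℕ → Letter

data LetterMove : List Letter → List Letter → Set where
  commU  : ∀ j k → 1 < ∣ j - k ∣ → LetterMove (under j ∷ under k ∷ []) (under k ∷ under j ∷ [])
  commO  : ∀ j k → 1 < ∣ j - k ∣ → LetterMove (over j ∷ over k ∷ []) (over k ∷ over j ∷ [])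
  commUO : ∀ j k → LetterMove (under j ∷ over k ∷ []) (over k ∷ under j ∷ [])
  commOU : ∀ j k → LetterMove (over k ∷ under j ∷ []) (under j ∷ over k ∷ [])
  braidU  : ∀ j → LetterMove (under j ∷ under (suc j) ∷ under j ∷ [])
                             (under (suc j) ∷ under j ∷ under (suc j) ∷ [])
  braidU′ : ∀ j → LetterMove (under (suc j) ∷ under j ∷ under (suc j) ∷ [])
                             (under j ∷ under (suc j) ∷ under j ∷ [])
  braidO  : ∀ j → LetterMove (over j ∷ over (suc j) ∷ over j ∷ [])
                             (over (suc j) ∷ over j ∷ over (suc j) ∷ [])
  braidO′ : ∀ j → LetterMove (over (suc j) ∷ over j ∷ over (suc j) ∷ [])
                             (over j ∷ over (suc j) ∷ over j ∷ [])

LetterAdj : List Letter → List Letter → Set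
LetterAdj = Step LetterMove

data Shuffle {A : Set} : List A → List A → List A → Set where
  []  : Shuffle [] [] []
  inl : ∀ {x u v w} → Shuffle u v w → Shuffle (x ∷ u) v (x ∷ w)
  inr : ∀ {x u v w} → Shuffle u v w → Shuffle u (x ∷ v) (x ∷ w)

U : {a b : ℕ} → Permutation′ a → Permutation′ b → List Letter → Set
U {a} {b} α β w = Σ (List ℕ) λ u → Σ (List ℕ) λ v →
  Reduced a (toFun α) u × Reduced b (toFun β) v × Shuffle (map under u) (map over v) w

ηL : ℕ → Letter → ℕ
ηL a (under j) = j
ηL a (over j)  = j + a

η : ℕ → List Letter → List ℕ
η a = map (ηL a)

record GraphIso {A B : Set} (V₁ : A → Set) (E₁ : A → A → Set)
                (V₂ : B → Set) (E₂ : B → B → Set) : Set where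
  field
    to      : Σ A V₁ → Σ B V₂
    from    : Σ B V₂ → Σ A V₁
    from∘to : ∀ x → proj₁ (from (to x)) ≡ proj₁ x
    to∘from : ∀ y → proj₁ (to (from y)) ≡ proj₁ y
    adj⇒    : ∀ x y → E₁ (proj₁ x) (proj₁ y) → E₂ (proj₁ (to x)) (proj₁ (to y))
    adj⇐    : ∀ x y → E₂ (proj₁ (to x)) (proj₁ (to y)) → E₁ (proj₁ x) (proj₁ y)

-- A word is reduced iff its length equals the number of inversions of its product.
-- Along a reduced word every letter creates an inversion that is never undone, and
-- s_a would create one between a value ≤ a and a value > a, which 12[α, β] does not
-- have; so reduced words of 12[α, β] avoid a.  Their letters then split into those
-- below a, acting on {1..a} as a word for α, and those above a, acting on {a+1..a+b}
-- as a shifted word for β.  Products and lengths split accordingly, so reduced words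
-- of 12[α, β] are exactly shuffles of reduced words of α and β.  Letterwise, η is
-- inverted by c ↦ c̲ for c < a and c ↦ (c − a)‾ otherwise, and commutations and
-- braids correspond under η, which gives the graph isomorphism.

module Submission where

open import Defs
open import Data.Nat using (ℕ; _+_)
open import Data.Fin.Permutation using (Permutation′)
open import Data.List using (List)
open import Data.Product using (Σ; _×_)
open import Relation.Binary.PropositionalEquality using (_≡_)

open import Data.Empty using (⊥; ⊥-elim)
open import Data.Fin using (toℕ; fromℕ<)
open import Data.Fin.Properties using (toℕ<n)
open import Data.Fin.Permutation using (_⟨$⟩ʳ_)
open import Data.List using ([]; _∷_; _++_; [_]; length; map)
open import Data.List.Properties using (map-++; length-map; length-++; ++-assoc; ++-identityʳ)
open import Data.List.Relation.Unary.All as All using (All; []; _∷_)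
open import Data.List.Relation.Unary.All.Properties as Allₚ using (++⁻ˡ; ++⁻ʳ)
open import Data.Nat using (zero; suc; _∸_; _≤_; _<_; z≤n; s≤s; ∣_-_∣)
open import Data.Nat.Properties
open import Algebra.Properties.CommutativeSemigroup +-commutativeSemigroup using (x∙yz≈y∙xz)
open import Data.Product using (_,_; proj₁; proj₂; map₁; map₂; ∃; ∃₂)
open import Data.Sum using (_⊎_; inj₁; inj₂)
open import Relation.Binary.Definitions using (tri<; tri≈; tri>)
open import Relation.Binary.PropositionalEquality
  using (_≢_; refl; sym; trans; cong; cong₂; subst; subst₂; module ≡-Reasoning)
open import Relation.Nullary using (Dec; yes; no; ¬_)

data Position (r i : ℕ) : Set where
  at-r   : i ≡ r → Position r i
  at-1+r : i ≡ suc r → Position r i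
  away   : i ≢ r → i ≢ suc r → Position r i

position : ∀ r i → Position r i
position r i with i ≟ r
... | yes i≡r = at-r i≡r
... | no i≢r with i ≟ suc r
...   | yes i≡1+r = at-1+r i≡1+r
...   | no i≢1+r  = away i≢r i≢1+r

s-at-r : ∀ r → s r r ≡ suc r
s-at-r r with r ≟ r
... | yes _   = refl
... | no r≢r = ⊥-elim (r≢r refl)

s-at-1+r : ∀ r → s r (suc r) ≡ r
s-at-1+r r with suc r ≟ r
... | yes 1+r≡r = ⊥-elim (1+n≢n 1+r≡r)
... | no _ with suc r ≟ suc r
...   | yes _ = refl
...   | no 1+r≢1+r = ⊥-elim (1+r≢1+r refl)

s-away : ∀ {r i} → i ≢ r → i ≢ suc r → s r i ≡ i
s-away {r} {i} i≢r i≢1+r with i ≟ r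
... | yes i≡r = ⊥-elim (i≢r i≡r)
... | no _ with i ≟ suc r
...   | yes i≡1+r = ⊥-elim (i≢1+r i≡1+r)
...   | no _ = refl

s-involutive : ∀ r i → s r (s r i) ≡ i
s-involutive r i with position r i
... | at-r refl   = trans (cong (s r) (s-at-r r)) (s-at-1+r r)
... | at-1+r refl = trans (cong (s r) (s-at-1+r r)) (s-at-r r)
... | away p q    = trans (cong (s r) (s-away p q)) (s-away p q)

s-injective : ∀ r {i j} → s r i ≡ s r j → i ≡ j
s-injective r {i} {j} e = trans (sym (s-involutive r i)) (trans (cong (s r) e) (s-involutive r j))

s-suc : ∀ r i → s (suc r) (suc i) ≡ suc (s r i)
s-suc r i with position r i
... | at-r refl   = trans (s-at-r (suc r)) (cong suc (sym (s-at-r r)))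
... | at-1+r refl = trans (s-at-1+r (suc r)) (cong suc (sym (s-at-1+r r)))
... | away p q    = trans (s-away (λ e → p (suc-injective e)) (λ e → q (suc-injective e)))
                          (cong suc (sym (s-away p q)))

s-+ʳ : ∀ a r i → s (r + a) (i + a) ≡ s r i + a
s-+ʳ zero r i rewrite +-identityʳ r | +-identityʳ i | +-identityʳ (s r i) = refl
s-+ʳ (suc a) r i rewrite +-suc r a | +-suc i a | +-suc (s r i) a =
  trans (s-suc (r + a) (i + a)) (cong suc (s-+ʳ a r i))

s-fixes-< : ∀ {r i} → i < r → s r i ≡ i
s-fixes-< {r} i<r = s-away (λ { refl → <-irrefl refl i<r }) (λ { refl → <-asym i<r (n<1+n r) })

s-fixes-> : ∀ {r i} → suc r < i → s r i ≡ i
s-fixes-> {r} 1+r<i = s-away (λ { refl → <-asym 1+r<i (n<1+n r) }) (λ { refl → <-irrefl refl 1+r<i })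

s-preserves-range : ∀ {n r i} → 1 ≤ r → r < n → 1 ≤ i → i ≤ n → 1 ≤ s r i × s r i ≤ n
s-preserves-range {r = r} {i} 1≤r r<n 1≤i i≤n with position r i
... | at-r refl   rewrite s-at-r r    = s≤s z≤n , r<n
... | at-1+r refl rewrite s-at-1+r r  = 1≤r , <⇒≤ r<n
... | away p q    rewrite s-away p q  = 1≤i , i≤n

s-preserves-≤ : ∀ {a r i} → r ≢ a → i ≤ a → s r i ≤ a
s-preserves-≤ {r = r} {i} r≢a i≤a with position r i
... | at-r refl   rewrite s-at-r r   = ≤∧≢⇒< i≤a r≢a
... | at-1+r refl rewrite s-at-1+r r = ≤-trans (n≤1+n r) i≤a
... | away p q    rewrite s-away p q = i≤a

s-preserves-> : ∀ {a r i} → r ≢ a → a < i → a < s r i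
s-preserves-> {r = r} {i} r≢a a<i with position r i
... | at-r refl   rewrite s-at-r r   = <-trans a<i (n<1+n r)
... | at-1+r refl rewrite s-at-1+r r = ≤∧≢⇒< (≤-pred a<i) (λ a≡r → r≢a (sym a≡r))
... | away p q    rewrite s-away p q = a<i

s-monotone : ∀ {r p q} → p < q → ¬ (p ≡ r × q ≡ suc r) → s r p < s r q
s-monotone {r} {p} {q} p<q not-r,1+r with position r p | position r q
... | at-r refl   | at-r refl   = ⊥-elim (<-irrefl refl p<q)
... | at-r refl   | at-1+r q≡  = ⊥-elim (not-r,1+r (refl , q≡))
... | at-r refl   | away x y    rewrite s-at-r r | s-away x y = ≤∧≢⇒< p<q (λ e → y (sym e))
... | at-1+r refl | at-r refl   = ⊥-elim (<-asym p<q (n<1+n r))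
... | at-1+r refl | at-1+r refl = ⊥-elim (<-irrefl refl p<q)
... | at-1+r refl | away x y    rewrite s-at-1+r r | s-away x y = <-trans (n<1+n r) p<q
... | away x y    | at-r refl   rewrite s-at-r r | s-away x y = <-trans p<q (n<1+n r)
... | away x y    | at-1+r refl rewrite s-at-1+r r | s-away x y = ≤∧≢⇒< (≤-pred p<q) x
... | away x y    | away x′ y′  rewrite s-away x y | s-away x′ y′ = p<q


IsWord : ℕ → List ℕ → Set
IsWord n w = All (λ r → 1 ≤ r × r < n) w

Agree : ℕ → (ℕ → ℕ) → (ℕ → ℕ) → Set
Agree n f g = ∀ i → 1 ≤ i → i ≤ n → f i ≡ g i

prod-++ : ∀ x y i → prod (x ++ y) i ≡ prod x (prod y i)
prod-++ []      y i = refl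
prod-++ (r ∷ x) y i = cong (s r) (prod-++ x y i)

prod-injective : ∀ w {i j} → prod w i ≡ prod w j → i ≡ j
prod-injective []      e = e
prod-injective (r ∷ w) e = prod-injective w (s-injective r e)

prod-preserves-range : ∀ {n w i} → IsWord n w → 1 ≤ i → i ≤ n → 1 ≤ prod w i × prod w i ≤ n
prod-preserves-range []                 1≤i i≤n = 1≤i , i≤n
prod-preserves-range ((1≤r , r<n) ∷ ws) 1≤i i≤n =
  let 1≤w[i] , w[i]≤n = prod-preserves-range ws 1≤i i≤n in s-preserves-range 1≤r r<n 1≤w[i] w[i]≤n

prod-preserves-≤ : ∀ {a w i} → All (_≢ a) w → i ≤ a → prod w i ≤ a
prod-preserves-≤ []            i≤a = i≤a
prod-preserves-≤ (r≢a ∷ w≢a) i≤a = s-preserves-≤ r≢a (prod-preserves-≤ w≢a i≤a)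

prod-preserves-> : ∀ {a w i} → All (_≢ a) w → a < i → a < prod w i
prod-preserves-> []            a<i = a<i
prod-preserves-> (r≢a ∷ w≢a) a<i = s-preserves-> r≢a (prod-preserves-> w≢a a<i)

-- Inversions

values : ℕ → (ℕ → ℕ) → List ℕ
values zero    g = []
values (suc n) g = g 1 ∷ values n (λ i → g (suc i))

indicator : {P : Set} → Dec P → ℕ
indicator (yes _) = 1
indicator (no _)  = 0

countBelow : ℕ → List ℕ → ℕ
countBelow x []       = 0
countBelow x (y ∷ ys) = indicator (y <? x) + countBelow x ys

inversions : List ℕ → ℕ
inversions []       = 0
inversions (x ∷ xs) = countBelow x xs + inversions xs

inv : ℕ → (ℕ → ℕ) → ℕ
inv n g = inversions (values n g)

values-cong : ∀ n {f g} → Agree n f g → values n f ≡ values n g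
values-cong zero    _   = refl
values-cong (suc n) f≗g =
  cong₂ _∷_ (f≗g 1 ≤-refl (s≤s z≤n)) (values-cong n (λ i 1≤i i≤n → f≗g (suc i) (s≤s z≤n) (s≤s i≤n)))

inv-cong : ∀ n {f g} → Agree n f g → inv n f ≡ inv n g
inv-cong n f≗g = cong inversions (values-cong n f≗g)

countBelow-mono : ∀ {x y} zs → x ≤ y → countBelow x zs ≤ countBelow y zs
countBelow-mono []       x≤y = z≤n
countBelow-mono {x} {y} (z ∷ zs) x≤y with z <? x | z <? y
... | yes _   | yes _   = s≤s (countBelow-mono zs x≤y)
... | yes z<x | no z≮y = ⊥-elim (z≮y (<-≤-trans z<x x≤y))
... | no _    | yes _   = m≤n⇒m≤1+n (countBelow-mono zs x≤y)
... | no _    | no _    = countBelow-mono zs x≤y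

values-s1-tail : ∀ m g → values m (λ i → g (s 1 (suc (suc i)))) ≡ values m (λ i → g (suc (suc i)))
values-s1-tail m g = values-cong m (λ i 1≤i _ → cong g (s-fixes-> (s≤s (s≤s 1≤i))))

values-s-suc : ∀ m r g → values m (λ i → g (s (suc r) (suc i))) ≡ values m (λ i → g (suc (s r i)))
values-s-suc m r g = values-cong m (λ i _ _ → cong g (s-suc r i))

countBelow-transpose : ∀ r n g z → 1 ≤ r → r < n →
                       countBelow z (values n (λ i → g (s r i))) ≡ countBelow z (values n g)
countBelow-transpose 1 (suc (suc m)) g z _ _
  rewrite s-at-r 1 | s-at-1+r 1 | values-s1-tail m g = x∙yz≈y∙xz (indicator (g 2 <? z)) (indicator (g 1 <? z)) _
countBelow-transpose 1 (suc zero) g z _ (s≤s ())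
countBelow-transpose (suc (suc r)) (suc m) g z _ (s≤s r<m)
  rewrite s-fixes-< {suc (suc r)} {1} (s≤s (s≤s z≤n)) | values-s-suc m (suc r) g =
  cong (indicator (g 1 <? z) +_) (countBelow-transpose (suc r) m (λ i → g (suc i)) z (s≤s z≤n) r<m)

inv-transpose-ascent : ∀ r n g → 1 ≤ r → r < n → g r < g (suc r) →
                       inv n (λ i → g (s r i)) ≡ suc (inv n g)
inv-transpose-ascent 1 (suc (suc m)) g _ _ g1<g2
  rewrite s-at-r 1 | s-at-1+r 1 | values-s1-tail m g with g 1 <? g 2 | g 2 <? g 1
... | yes _     | no _      = cong suc (x∙yz≈y∙xz (countBelow (g 2) rest) (countBelow (g 1) rest) _)
  where rest = values m (λ i → g (suc (suc i)))
... | no g1≮g2 | _         = ⊥-elim (g1≮g2 g1<g2)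
... | _         | yes g2<g1 = ⊥-elim (<-asym g1<g2 g2<g1)
inv-transpose-ascent 1 (suc zero) g _ (s≤s ()) _
inv-transpose-ascent (suc (suc r)) (suc m) g _ (s≤s r<m) ascent
  rewrite s-fixes-< {suc (suc r)} {1} (s≤s (s≤s z≤n)) | values-s-suc m (suc r) g =
  trans (cong₂ _+_ (countBelow-transpose (suc r) m (λ i → g (suc i)) (g 1) (s≤s z≤n) r<m)
                   (inv-transpose-ascent (suc r) m (λ i → g (suc i)) (s≤s z≤n) r<m ascent))
        (+-suc _ _)

inv-transpose-descent : ∀ r n g → 1 ≤ r → r < n → g (suc r) < g r →
                        suc (inv n (λ i → g (s r i))) ≡ inv n g
inv-transpose-descent r n g 1≤r r<n descent =
  trans (sym (inv-transpose-ascent r n (λ i → g (s r i)) 1≤r r<n ascent))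
        (inv-cong n (λ i _ _ → cong g (s-involutive r i)))
  where
  ascent : g (s r r) < g (s r (suc r))
  ascent rewrite s-at-r r | s-at-1+r r = descent

Descent : ℕ → (ℕ → ℕ) → Set
Descent n g = ∃ λ r → 1 ≤ r × r < n × g (suc r) < g r

descent-or-inv≡0 : ∀ n g → Descent n g ⊎ inv n g ≡ 0
descent-or-inv≡0 zero          g = inj₂ refl
descent-or-inv≡0 (suc zero)    g = inj₂ refl
descent-or-inv≡0 (suc (suc m)) g with g 2 <? g 1 | descent-or-inv≡0 (suc m) (λ i → g (suc i))
... | yes g2<g1 | _ = inj₁ (1 , ≤-refl , s≤s (s≤s z≤n) , g2<g1)
... | no _      | inj₁ (r , 1≤r , r<1+m , descent) = inj₁ (suc r , s≤s z≤n , s≤s r<1+m , descent)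
... | no g2≮g1  | inj₂ tail≡0 = inj₂ (cong₂ _+_ head≡0 tail≡0)
  where
  rest = values m (λ i → g (suc (suc i)))
  head≡0 : countBelow (g 1) rest ≡ 0
  head≡0 = n≤0⇒n≡0 (≤-trans (countBelow-mono rest (≮⇒≥ g2≮g1))
                            (≤-reflexive (m+n≡0⇒m≡0 (countBelow (g 2) rest) tail≡0)))

inv-id : ∀ n → inv n (λ i → i) ≡ 0
inv-id n with descent-or-inv≡0 n (λ i → i)
... | inj₁ (r , _ , _ , 1+r<r) = ⊥-elim (<-asym 1+r<r (n<1+n r))
... | inj₂ inv≡0 = inv≡0

countBelow≡0⇒≤ : ∀ x m h → countBelow x (values m h) ≡ 0 → ∀ j → 1 ≤ j → j ≤ m → x ≤ h j
countBelow≡0⇒≤ x zero h e (suc j) 1≤j ()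
countBelow≡0⇒≤ x (suc m) h e j 1≤j j≤m with h 1 <? x
countBelow≡0⇒≤ x (suc m) h () j 1≤j j≤m | yes _
countBelow≡0⇒≤ x (suc m) h e 1 1≤j j≤m | no h1≮x = ≮⇒≥ h1≮x
countBelow≡0⇒≤ x (suc m) h e (suc (suc j)) 1≤j (s≤s j≤m) | no _ =
  countBelow≡0⇒≤ x m (λ i → h (suc i)) e (suc j) (s≤s z≤n) j≤m

inv≡0⇒sorted : ∀ n g → inv n g ≡ 0 → ∀ i j → 1 ≤ i → i < j → j ≤ n → g i ≤ g j
inv≡0⇒sorted (suc m) g e 1 1 _ (s≤s ()) _
inv≡0⇒sorted (suc m) g e 1 (suc (suc j)) _ _ (s≤s j≤m) =
  countBelow≡0⇒≤ (g 1) m (λ i → g (suc i)) (m+n≡0⇒m≡0 _ e) (suc j) (s≤s z≤n) j≤m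
inv≡0⇒sorted (suc m) g e (suc (suc i)) (suc j) _ (s≤s i<j) (s≤s j≤m) =
  inv≡0⇒sorted m (λ k → g (suc k)) (m+n≡0⇒n≡0 (countBelow (g 1) (values m (λ k → g (suc k)))) e)
    (suc i) j (s≤s z≤n) i<j j≤m

-- A strictly increasing self-map of [1, n] is the identity: g i ≥ i counting up from 1,
-- and g i + (n − i) ≤ n counting down from n.
increasing⇒id : ∀ n g → (∀ i → 1 ≤ i → suc i ≤ n → g i < g (suc i)) →
                (∀ i → 1 ≤ i → i ≤ n → 1 ≤ g i × g i ≤ n) → Agree n g (λ i → i)
increasing⇒id n g increasing range i 1≤i i≤n = ≤-antisym g[i]≤i (i≤g[i] i 1≤i i≤n)
  where
  i≤g[i] : ∀ i → 1 ≤ i → i ≤ n → i ≤ g i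
  i≤g[i] 1             1≤i i≤n = proj₁ (range 1 1≤i i≤n)
  i≤g[i] (suc (suc i)) _   i≤n =
    ≤-trans (s≤s (i≤g[i] (suc i) (s≤s z≤n) (≤-trans (n≤1+n _) i≤n))) (increasing (suc i) (s≤s z≤n) i≤n)
  g[i]+d≤n : ∀ d i → 1 ≤ i → d + i ≤ n → g i + d ≤ n
  g[i]+d≤n zero    i 1≤i i≤n = subst (_≤ n) (sym (+-identityʳ (g i))) (proj₂ (range i 1≤i i≤n))
  g[i]+d≤n (suc d) i 1≤i d+i<n = subst (_≤ n) (sym (+-suc (g i) d))
    (≤-trans (+-monoˡ-≤ d (increasing i 1≤i (≤-trans (s≤s (m≤n+m i d)) d+i<n)))
             (g[i]+d≤n d (suc i) (s≤s z≤n) (subst (_≤ n) (sym (+-suc d i)) d+i<n)))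
  g[i]≤i : g i ≤ i
  g[i]≤i = +-cancelʳ-≤ (n ∸ i) (g i) i
             (≤-trans (g[i]+d≤n (n ∸ i) i 1≤i (≤-reflexive (m∸n+n≡m i≤n)))
                      (≤-reflexive (trans (sym (m∸n+n≡m i≤n)) (+-comm (n ∸ i) i))))

inv≡0⇒id : ∀ n w → IsWord n w → inv n (prod w) ≡ 0 → Agree n (prod w) (λ i → i)
inv≡0⇒id n w ws inv≡0 = increasing⇒id n (prod w) increasing (λ i → prod-preserves-range ws)
  where
  increasing : ∀ i → 1 ≤ i → suc i ≤ n → prod w i < prod w (suc i)
  increasing i 1≤i 1+i≤n = ≤∧≢⇒< (inv≡0⇒sorted n (prod w) inv≡0 i (suc i) 1≤i ≤-refl 1+i≤n)
                                  (λ e → 1+n≢n (sym (prod-injective w e)))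

-- Bubble sort: appending the letter of a descent lowers the inversion number by one.
sorting-word : ∀ n k w → IsWord n w → inv n (prod w) ≡ k →
               Σ (List ℕ) λ z → IsWord n z × length z ≡ k × Agree n (prod z) (prod w)
sorting-word n zero w ws inv≡0 =
  [] , [] , refl , λ i 1≤i i≤n → sym (inv≡0⇒id n w ws inv≡0 i 1≤i i≤n)
sorting-word n (suc k) w ws inv≡1+k with descent-or-inv≡0 n (prod w)
... | inj₂ inv≡0 = ⊥-elim (1+n≢0 (trans (sym inv≡1+k) inv≡0))
... | inj₁ (r , 1≤r , r<n , descent)
  with sorting-word n k (w ++ [ r ]) (Allₚ.++⁺ ws ((1≤r , r<n) ∷ []))
         (suc-injective (trans (cong suc (inv-cong n (λ i _ _ → prod-++ w [ r ] i)))
                               (trans (inv-transpose-descent r n (prod w) 1≤r r<n descent) inv≡1+k)))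
...   | z , zs , |z|≡k , z≗wr =
  z ++ [ r ] , Allₚ.++⁺ zs ((1≤r , r<n) ∷ []) ,
  trans (length-++ z) (trans (+-comm (length z) 1) (cong suc |z|≡k)) ,
  λ i 1≤i i≤n → let 1≤s[i] , s[i]≤n = s-preserves-range 1≤r r<n 1≤i i≤n in begin
    prod (z ++ [ r ]) i      ≡⟨ prod-++ z [ r ] i ⟩
    prod z (s r i)           ≡⟨ z≗wr (s r i) 1≤s[i] s[i]≤n ⟩
    prod (w ++ [ r ]) (s r i) ≡⟨ prod-++ w [ r ] (s r i) ⟩
    prod w (s r (s r i))     ≡⟨ cong (prod w) (s-involutive r i) ⟩
    prod w i                 ∎
  where open ≡-Reasoning

inv-snoc-≤ : ∀ n x c → 1 ≤ c → c < n → inv n (prod (x ++ [ c ])) ≤ suc (inv n (prod x))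
inv-snoc-≤ n x c 1≤c c<n
  rewrite inv-cong n (λ i _ _ → prod-++ x [ c ] i) with <-cmp (prod x c) (prod x (suc c))
... | tri< ascent _ _  = ≤-reflexive (inv-transpose-ascent c n (prod x) 1≤c c<n ascent)
... | tri≈ _ x[c]≡x[1+c] _ = ⊥-elim (1+n≢n (sym (prod-injective x x[c]≡x[1+c])))
... | tri> _ _ descent = m≤n⇒m≤1+n (≤-trans (n≤1+n _)
                           (≤-reflexive (inv-transpose-descent c n (prod x) 1≤c c<n descent)))

inv-++-≤ : ∀ n x y → IsWord n y → inv n (prod (x ++ y)) ≤ inv n (prod x) + length y
inv-++-≤ n x [] [] = ≤-reflexive (trans (cong (λ w → inv n (prod w)) (++-identityʳ x)) (sym (+-identityʳ _)))
inv-++-≤ n x (c ∷ y) ((1≤c , c<n) ∷ ys) = begin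
  inv n (prod (x ++ c ∷ y))              ≡⟨ cong (λ w → inv n (prod w)) (sym (++-assoc x [ c ] y)) ⟩
  inv n (prod ((x ++ [ c ]) ++ y))       ≤⟨ inv-++-≤ n (x ++ [ c ]) y ys ⟩
  inv n (prod (x ++ [ c ])) + length y   ≤⟨ +-monoˡ-≤ (length y) (inv-snoc-≤ n x c 1≤c c<n) ⟩
  suc (inv n (prod x)) + length y        ≡⟨ sym (+-suc _ (length y)) ⟩
  inv n (prod x) + length (c ∷ y)        ∎
  where open ≤-Reasoning

inv≤length : ∀ n w → IsWord n w → inv n (prod w) ≤ length w
inv≤length n w ws = subst (λ k → inv n (prod w) ≤ k + length w) (inv-id n) (inv-++-≤ n [] w ws)

reduced⇒length≡inv : ∀ {n f r} → Reduced n f r → length r ≡ inv n f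
reduced⇒length≡inv {n} {f} {r} ((rs , r≗f) , minimal) with sorting-word n _ r rs refl
... | z , zs , |z|≡inv , z≗r = ≤-antisym
  (≤-trans (minimal z (zs , λ i 1≤i i≤n → trans (z≗r i 1≤i i≤n) (r≗f i 1≤i i≤n)))
           (≤-reflexive (trans |z|≡inv (inv-cong n r≗f))))
  (≤-trans (≤-reflexive (sym (inv-cong n r≗f))) (inv≤length n r rs))

length≡inv⇒reduced : ∀ {n f r} → IsWordFor n f r → length r ≡ inv n f → Reduced n f r
length≡inv⇒reduced {n} {f} {r} r-for-f |r|≡inv = r-for-f , λ w (ws , w≗f) → begin
  length r        ≡⟨ |r|≡inv ⟩
  inv n f         ≡⟨ sym (inv-cong n w≗f) ⟩
  inv n (prod w)  ≤⟨ inv≤length n w ws ⟩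
  length w        ∎
  where open ≤-Reasoning

reduced-exists : ∀ {n f w} → IsWordFor n f w → Σ (List ℕ) (Reduced n f)
reduced-exists {n} {f} {w} (ws , w≗f) with sorting-word n _ w ws refl
... | z , zs , |z|≡inv , z≗w =
  z , length≡inv⇒reduced (zs , λ i 1≤i i≤n → trans (z≗w i 1≤i i≤n) (w≗f i 1≤i i≤n))
                         (trans |z|≡inv (inv-cong n w≗f))

reduced-ascent : ∀ {n f} x c y → Reduced n f (x ++ c ∷ y) → prod x c < prod x (suc c)
reduced-ascent {n} {f} x c y R@((rs , r≗f) , _) with <-cmp (prod x c) (prod x (suc c))
... | tri< ascent _ _ = ascent
... | tri≈ _ x[c]≡x[1+c] _ = ⊥-elim (1+n≢n (sym (prod-injective x x[c]≡x[1+c])))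
... | tri> _ _ descent = ⊥-elim (<-irrefl refl (begin-strict
  length (x ++ c ∷ y)                  ≡⟨ reduced⇒length≡inv R ⟩
  inv n f                              ≡⟨ sym (inv-cong n r≗f) ⟩
  inv n (prod (x ++ c ∷ y))            ≡⟨ cong (λ w → inv n (prod w)) (sym (++-assoc x [ c ] y)) ⟩
  inv n (prod ((x ++ [ c ]) ++ y))     ≤⟨ inv-++-≤ n (x ++ [ c ]) y ys ⟩
  inv n (prod (x ++ [ c ])) + length y <⟨ +-monoˡ-< (length y) shorter ⟩
  length x + length y                  ≤⟨ +-monoʳ-≤ (length x) (n≤1+n (length y)) ⟩
  length x + length (c ∷ y)            ≡⟨ sym (length-++ x) ⟩
  length (x ++ c ∷ y)                  ∎))
  where
  open ≤-Reasoning
  xs = ++⁻ˡ x rs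
  1≤c,c<n = All.head (++⁻ʳ x rs)
  ys = All.tail (++⁻ʳ x rs)
  shorter : inv n (prod (x ++ [ c ])) < length x
  shorter = begin-strict
    inv n (prod (x ++ [ c ]))           ≡⟨ inv-cong n (λ i _ _ → prod-++ x [ c ] i) ⟩
    inv n (λ i → prod x (s c i))        <⟨ n<1+n _ ⟩
    suc (inv n (λ i → prod x (s c i)))  ≡⟨ inv-transpose-descent c n (prod x) (proj₁ 1≤c,c<n) (proj₂ 1≤c,c<n) descent ⟩
    inv n (prod x)                      ≤⟨ inv≤length n x xs ⟩
    length x                            ∎

-- Inversions persist along reduced words

data Precedes (n : ℕ) (g : ℕ → ℕ) (hi lo : ℕ) : Set where
  positions : ∀ {p q} → 1 ≤ p → p < q → q ≤ n → g p ≡ hi → g q ≡ lo → Precedes n g hi lo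

precedes-cong : ∀ {n f g hi lo} → Agree n f g → Precedes n f hi lo → Precedes n g hi lo
precedes-cong f≗g (positions 1≤p p<q q≤n f[p] f[q]) =
  positions 1≤p p<q q≤n (trans (sym (f≗g _ 1≤p (≤-trans (<⇒≤ p<q) q≤n))) f[p])
                        (trans (sym (f≗g _ (≤-trans (s≤s z≤n) p<q) q≤n)) f[q])

precedes-persists : ∀ {n f hi lo} x y → Reduced n f (x ++ y) → lo < hi →
                    Precedes n (prod x) hi lo → Precedes n (prod (x ++ y)) hi lo
precedes-persists {n} {hi = hi} {lo} x [] _ _ P =
  subst (λ w → Precedes n (prod w) hi lo) (sym (++-identityʳ x)) P
precedes-persists {n} {f} {hi} {lo} x (c ∷ y) R lo<hi (positions {p} {q} 1≤p p<q q≤n x[p] x[q]) =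
  subst (λ w → Precedes n (prod w) hi lo) (++-assoc x [ c ] y)
        (precedes-persists (x ++ [ c ]) y R′ lo<hi
          (positions (proj₁ (s-preserves-range 1≤c c<n 1≤p p≤n))
                     (s-monotone p<q not-c,1+c)
                     (proj₂ (s-preserves-range 1≤c c<n (≤-trans (s≤s z≤n) p<q) q≤n))
                     (after-c x[p]) (after-c x[q])))
  where
  R′ : Reduced n f ((x ++ [ c ]) ++ y)
  R′ = subst (Reduced n f) (sym (++-assoc x [ c ] y)) R
  p≤n = ≤-trans (<⇒≤ p<q) q≤n
  1≤c = proj₁ (All.head (++⁻ʳ x (proj₁ (proj₁ R))))
  c<n = proj₂ (All.head (++⁻ʳ x (proj₁ (proj₁ R))))
  after-c : ∀ {i v} → prod x i ≡ v → prod (x ++ [ c ]) (s c i) ≡ v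
  after-c {i} x[i] = trans (prod-++ x [ c ] (s c i)) (trans (cong (prod x) (s-involutive c i)) x[i])
  not-c,1+c : ¬ (p ≡ c × q ≡ suc c)
  not-c,1+c (refl , refl) = <-asym lo<hi (subst₂ _<_ x[p] x[q] (reduced-ascent x c y R))

all-≢-or-split : ∀ a r → All (_≢ a) r ⊎ ∃₂ λ x y → r ≡ x ++ a ∷ y × All (_≢ a) x
all-≢-or-split a [] = inj₁ []
all-≢-or-split a (c ∷ r) with c ≟ a
... | yes refl = inj₂ ([] , r , refl , [])
... | no c≢a with all-≢-or-split a r
...   | inj₁ r≢a = inj₁ (c≢a ∷ r≢a)
...   | inj₂ (x , y , refl , x≢a) = inj₂ (c ∷ x , y , refl , c≢a ∷ x≢a)

Admissible : ℕ → ℕ → Letter → Set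
Admissible a b (under j) = 1 ≤ j × j < a
Admissible a b (over k)  = 1 ≤ k × k < b

unders : List Letter → List ℕ
unders []            = []
unders (under j ∷ w) = j ∷ unders w
unders (over _ ∷ w)  = unders w

overs : List Letter → List ℕ
overs []            = []
overs (under _ ∷ w) = overs w
overs (over k ∷ w)  = k ∷ overs w

length-unders-overs : ∀ w → length w ≡ length (unders w) + length (overs w)
length-unders-overs []            = refl
length-unders-overs (under j ∷ w) = cong suc (length-unders-overs w)
length-unders-overs (over k ∷ w)  = trans (cong suc (length-unders-overs w)) (sym (+-suc _ _))

length-η : ∀ a w → length (η a w) ≡ length (unders w) + length (overs w)
length-η a w = trans (length-map (ηL a) w) (length-unders-overs w)

shuffle-unders-overs : ∀ w → Shuffle (map under (unders w)) (map over (overs w)) w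
shuffle-unders-overs []            = []
shuffle-unders-overs (under j ∷ w) = inl (shuffle-unders-overs w)
shuffle-unders-overs (over k ∷ w)  = inr (shuffle-unders-overs w)

shuffle⇒unders-overs : ∀ u v {w} → Shuffle (map under u) (map over v) w → unders w ≡ u × overs w ≡ v
shuffle⇒unders-overs []      []      []      = refl , refl
shuffle⇒unders-overs []      (k ∷ v) (inr S) = map₂ (cong (k ∷_)) (shuffle⇒unders-overs [] v S)
shuffle⇒unders-overs (j ∷ u) []      (inl S) = map₁ (cong (j ∷_)) (shuffle⇒unders-overs u [] S)
shuffle⇒unders-overs (j ∷ u) (k ∷ v) (inl S) = map₁ (cong (j ∷_)) (shuffle⇒unders-overs u (k ∷ v) S)
shuffle⇒unders-overs (j ∷ u) (k ∷ v) (inr S) = map₂ (cong (k ∷_)) (shuffle⇒unders-overs (j ∷ u) v S)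

join : List ℕ → List ℕ → List Letter
join u v = map under u ++ map over v

shuffle-++ : ∀ {A : Set} (xs ys : List A) → Shuffle xs ys (xs ++ ys)
shuffle-++ []       []       = []
shuffle-++ []       (y ∷ ys) = inr (shuffle-++ [] ys)
shuffle-++ (x ∷ xs) ys       = inl (shuffle-++ xs ys)

unders-overs-join : ∀ u v → unders (join u v) ≡ u × overs (join u v) ≡ v
unders-overs-join u v = shuffle⇒unders-overs u v (shuffle-++ (map under u) (map over v))

module _ {a b : ℕ} where

  admissible⁺ : ∀ {w} → IsWord a (unders w) → IsWord b (overs w) → All (Admissible a b) w
  admissible⁺ {[]}          _         _         = []
  admissible⁺ {under j ∷ w} (j∈ ∷ us) vs        = j∈ ∷ admissible⁺ us vs
  admissible⁺ {over k ∷ w}  us        (k∈ ∷ vs) = k∈ ∷ admissible⁺ us vs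

  admissible⁻ : ∀ {w} → All (Admissible a b) w → IsWord a (unders w) × IsWord b (overs w)
  admissible⁻ {[]}          []        = [] , []
  admissible⁻ {under j ∷ w} (j∈ ∷ ws) = let us , vs = admissible⁻ ws in j∈ ∷ us , vs
  admissible⁻ {over k ∷ w}  (k∈ ∷ ws) = let us , vs = admissible⁻ ws in us , k∈ ∷ vs

  η-isWord : ∀ {w} → All (Admissible a b) w → IsWord (a + b) (η a w)
  η-isWord {[]}          []                  = []
  η-isWord {under j ∷ w} ((1≤j , j<a) ∷ ws) = (1≤j , ≤-trans j<a (m≤m+n a b)) ∷ η-isWord ws
  η-isWord {over k ∷ w}  ((1≤k , k<b) ∷ ws) =
    (≤-trans 1≤k (m≤m+n k a) , subst (k + a <_) (+-comm b a) (+-monoˡ-< a k<b)) ∷ η-isWord ws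

  prod-η-low : ∀ {w i} → All (Admissible a b) w → i ≤ a → prod (η a w) i ≡ prod (unders w) i
  prod-η-low {[]}          []                 i≤a = refl
  prod-η-low {under j ∷ w} (_ ∷ ws)           i≤a = cong (s j) (prod-η-low ws i≤a)
  prod-η-low {over k ∷ w}  ((1≤k , _) ∷ ws) i≤a = trans (cong (s (k + a)) (prod-η-low ws i≤a))
    (s-fixes-< (≤-<-trans (prod-preserves-≤ (All.map (λ j∈ → <⇒≢ (proj₂ j∈)) (proj₁ (admissible⁻ ws))) i≤a)
                          (+-monoˡ-≤ a 1≤k)))

  prod-η-high : ∀ {w t} → All (Admissible a b) w → 1 ≤ t → t ≤ b → prod (η a w) (t + a) ≡ prod (overs w) t + a
  prod-η-high {[]}          []                  1≤t t≤b = refl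
  prod-η-high {under j ∷ w} ((_ , j<a) ∷ ws)   1≤t t≤b = trans (cong (s j) (prod-η-high ws 1≤t t≤b))
    (s-fixes-> (≤-<-trans j<a (+-monoˡ-≤ a (proj₁ (prod-preserves-range (proj₂ (admissible⁻ ws)) 1≤t t≤b)))))
  prod-η-high {over k ∷ w} {t} (_ ∷ ws)       1≤t t≤b =
    trans (cong (s (k + a)) (prod-η-high ws 1≤t t≤b)) (s-+ʳ a k (prod (overs w) t))


ηL⁻¹ : ℕ → ℕ → Letter
ηL⁻¹ a c with c <? a
... | yes _ = under c
... | no _  = over (c ∸ a)

η⁻¹ : ℕ → List ℕ → List Letter
η⁻¹ a = map (ηL⁻¹ a)

ηL-ηL⁻¹ : ∀ a c → ηL a (ηL⁻¹ a c) ≡ c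
ηL-ηL⁻¹ a c with c <? a
... | yes _   = refl
... | no c≮a = m∸n+n≡m (≮⇒≥ c≮a)

ηL-ηL⁻¹-suc : ∀ a j → ηL a (ηL⁻¹ a (suc j)) ≡ suc (ηL a (ηL⁻¹ a j))
ηL-ηL⁻¹-suc a j = trans (ηL-ηL⁻¹ a (suc j)) (cong suc (sym (ηL-ηL⁻¹ a j)))

η-η⁻¹ : ∀ a r → η a (η⁻¹ a r) ≡ r
η-η⁻¹ a []      = refl
η-η⁻¹ a (c ∷ r) = cong₂ _∷_ (ηL-ηL⁻¹ a c) (η-η⁻¹ a r)

module _ {a b : ℕ} where

  ηL⁻¹-ηL : ∀ {l} → Admissible a b l → ηL⁻¹ a (ηL a l) ≡ l
  ηL⁻¹-ηL {under j} (_ , j<a) with j <? a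
  ... | yes _   = refl
  ... | no j≮a = ⊥-elim (j≮a j<a)
  ηL⁻¹-ηL {over k} (1≤k , _) with k + a <? a
  ... | yes k+a<a = ⊥-elim (<⇒≱ k+a<a (m≤n+m a k))
  ... | no _      = cong over (m+n∸n≡m k a)

  η⁻¹-η : ∀ {w} → All (Admissible a b) w → η⁻¹ a (η a w) ≡ w
  η⁻¹-η []         = refl
  η⁻¹-η (l∈ ∷ ws) = cong₂ _∷_ (ηL⁻¹-ηL l∈) (η⁻¹-η ws)

  η-injective : ∀ {w w′} → All (Admissible a b) w → All (Admissible a b) w′ → η a w ≡ η a w′ → w ≡ w′
  η-injective {w} {w′} ws ws′ ηw≡ηw′ = begin
    w                ≡⟨ sym (η⁻¹-η ws) ⟩
    η⁻¹ a (η a w)    ≡⟨ cong (η⁻¹ a) ηw≡ηw′ ⟩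
    η⁻¹ a (η a w′)   ≡⟨ η⁻¹-η ws′ ⟩
    w′               ∎
    where open ≡-Reasoning

  ηL⁻¹-admissible : ∀ {c} → 1 ≤ c → c < a + b → c ≢ a → Admissible a b (ηL⁻¹ a c)
  ηL⁻¹-admissible {c} 1≤c c<a+b c≢a with c <? a
  ... | yes c<a = 1≤c , c<a
  ... | no c≮a  = m<n⇒0<n∸m a<c , subst (c ∸ a <_) (m+n∸m≡n a b) (∸-monoˡ-< c<a+b (<⇒≤ a<c))
    where a<c = ≤∧≢⇒< (≮⇒≥ c≮a) (λ a≡c → c≢a (sym a≡c))

  η⁻¹-admissible : ∀ {r} → IsWord (a + b) r → All (_≢ a) r → All (Admissible a b) (η⁻¹ a r)
  η⁻¹-admissible []                   []            = []
  η⁻¹-admissible ((1≤c , c<n) ∷ rs) (c≢a ∷ r≢a) = ηL⁻¹-admissible 1≤c c<n c≢a ∷ η⁻¹-admissible rs r≢a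

∣m+o-n+o∣≡∣m-n∣ : ∀ m n o → ∣ m + o - n + o ∣ ≡ ∣ m - n ∣
∣m+o-n+o∣≡∣m-n∣ m n o rewrite +-comm m o | +-comm n o = ∣m+n-m+o∣≡∣n-o∣ o m n

under-over-apart : ∀ {a j k} → j < a → 1 ≤ k → 1 < ∣ j - k + a ∣
under-over-apart {a} {j} {k} j<a 1≤k =
  subst (1 <_) (sym (m≤n⇒∣m-n∣≡n∸m (≤-trans (<⇒≤ j<a) (m≤n+m a k))))
        (m+n≤o⇒m≤o∸n 2 (≤-trans (s≤s j<a) (+-monoˡ-≤ a 1≤k)))

LetterMove-sym : ∀ {l l′} → LetterMove l l′ → LetterMove l′ l
LetterMove-sym (commU j k d)  = commU k j (subst (1 <_) (∣-∣-comm j k) d)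
LetterMove-sym (commO j k d)  = commO k j (subst (1 <_) (∣-∣-comm j k) d)
LetterMove-sym (commUO j k)   = commOU j k
LetterMove-sym (commOU j k)   = commUO j k
LetterMove-sym (braidU j)     = braidU′ j
LetterMove-sym (braidU′ j)    = braidU j
LetterMove-sym (braidO j)     = braidO′ j
LetterMove-sym (braidO′ j)    = braidO j

commute-move : ∀ {a} A B → 1 < ∣ ηL a A - ηL a B ∣ → LetterMove (A ∷ B ∷ []) (B ∷ A ∷ [])
commute-move     (under j) (under k) d = commU j k d
commute-move {a} (over j)  (over k)  d = commO j k (subst (1 <_) (∣m+o-n+o∣≡∣m-n∣ j k a) d)
commute-move     (under j) (over k)  _ = commUO j k
commute-move     (over k)  (under j) _ = commOU j k

map-++₃ : ∀ {A B : Set} (f : A → B) x y z → map f (x ++ y ++ z) ≡ map f x ++ map f y ++ map f z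
map-++₃ f x y z = trans (map-++ f x (y ++ z)) (cong (map f x ++_) (map-++ f y z))

module _ {a b : ℕ} where

  braid-move : ∀ A B → Admissible a b A → Admissible a b B → ηL a B ≡ suc (ηL a A) →
               LetterMove (A ∷ B ∷ A ∷ []) (B ∷ A ∷ B ∷ [])
  braid-move (under j) (under .(suc j)) _ _ refl = braidU j
  braid-move (over j)  (over k)  _ _ k+a≡1+j+a with +-cancelʳ-≡ a k (suc j) k+a≡1+j+a
  ... | refl = braidO j
  braid-move (under j) (over k)  (_ , j<a) (1≤k , _) k+a≡1+j =
    ⊥-elim (<⇒≱ (+-monoˡ-≤ a 1≤k) (subst (_≤ a) (sym k+a≡1+j) j<a))
  braid-move (over k)  (under j) _ (_ , j<a) j≡1+k+a =
    ⊥-elim (<⇒≱ j<a (subst (a ≤_) (sym j≡1+k+a) (≤-trans (m≤n+m a k) (n≤1+n _))))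

  η-move : ∀ {l l′} → All (Admissible a b) l → LetterMove l l′ → NatMove (η a l) (η a l′)
  η-move _ (commU j k d) = comm j k d
  η-move _ (commO j k d) = comm (j + a) (k + a) (subst (1 <_) (sym (∣m+o-n+o∣≡∣m-n∣ j k a)) d)
  η-move ((_ , j<a) ∷ (1≤k , _) ∷ []) (commUO j k) = comm j (k + a) (under-over-apart j<a 1≤k)
  η-move ((1≤k , _) ∷ (_ , j<a) ∷ []) (commOU j k) =
    comm (k + a) j (subst (1 <_) (∣-∣-comm j (k + a)) (under-over-apart j<a 1≤k))
  η-move _ (braidU j)  = braid j
  η-move _ (braidU′ j) = braid′ j
  η-move _ (braidO j)  = braid (j + a)
  η-move _ (braidO′ j) = braid′ (j + a)

  η⁻¹-move : ∀ {l l′} → All (Admissible a b) (η⁻¹ a l) → NatMove l l′ → LetterMove (η⁻¹ a l) (η⁻¹ a l′)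
  η⁻¹-move _ (comm j k d) = commute-move (ηL⁻¹ a j) (ηL⁻¹ a k)
    (subst₂ (λ x y → 1 < ∣ x - y ∣) (sym (ηL-ηL⁻¹ a j)) (sym (ηL-ηL⁻¹ a k)) d)
  η⁻¹-move (j∈ ∷ 1+j∈ ∷ _) (braid j) = braid-move (ηL⁻¹ a j) (ηL⁻¹ a (suc j)) j∈ 1+j∈ (ηL-ηL⁻¹-suc a j)
  η⁻¹-move (1+j∈ ∷ j∈ ∷ _) (braid′ j) =
    LetterMove-sym (braid-move (ηL⁻¹ a j) (ηL⁻¹ a (suc j)) j∈ 1+j∈ (ηL-ηL⁻¹-suc a j))

  η-step : ∀ {w w′} → All (Admissible a b) w → LetterAdj w w′ → NatAdj (η a w) (η a w′)
  η-step ws (x , y , l , l′ , move , refl , refl) =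
    η a x , η a y , η a l , η a l′ , η-move (++⁻ˡ l (++⁻ʳ x ws)) move ,
    map-++₃ (ηL a) x l y , map-++₃ (ηL a) x l′ y

  η-step⁻¹ : ∀ {w w′} → All (Admissible a b) w → All (Admissible a b) w′ →
             NatAdj (η a w) (η a w′) → LetterAdj w w′
  η-step⁻¹ ws ws′ (x , y , l , l′ , move , ηw≡ , ηw′≡) =
    η⁻¹ a x , η⁻¹ a y , η⁻¹ a l , η⁻¹ a l′ ,
    η⁻¹-move (++⁻ˡ (η⁻¹ a l) (++⁻ʳ (η⁻¹ a x) (subst (All (Admissible a b)) (unη ws ηw≡) ws))) move ,
    unη ws ηw≡ , unη ws′ ηw′≡
    where
    unη : ∀ {v k} → All (Admissible a b) v → η a v ≡ x ++ k ++ y → v ≡ η⁻¹ a x ++ η⁻¹ a k ++ η⁻¹ a y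
    unη {v} {k} vs ηv≡ = trans (sym (η⁻¹-η vs)) (trans (cong (η⁻¹ a) ηv≡) (map-++₃ (ηL⁻¹ a) x k y))

toFun-range : ∀ {a} (α : Permutation′ a) i → 1 ≤ i → i ≤ a → 1 ≤ toFun α i × toFun α i ≤ a
toFun-range {a} α (suc k) _ k<a with k <? a
... | yes k<a′ = s≤s z≤n , toℕ<n (α ⟨$⟩ʳ fromℕ< k<a′)
... | no k≮a  = ⊥-elim (k≮a k<a)

toFun-positive : ∀ {a} (α : Permutation′ a) i → 1 ≤ i → 1 ≤ toFun α i
toFun-positive {a} α (suc k) _ with k <? a
... | yes _ = s≤s z≤n
... | no _  = s≤s z≤n

module _ {a b : ℕ} (α : Permutation′ a) (β : Permutation′ b) where

  oplus12-low : ∀ {i} → i ≤ a → oplus12 α β i ≡ toFun α i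
  oplus12-low {i} i≤a with a <? i
  ... | yes a<i = ⊥-elim (<⇒≱ a<i i≤a)
  ... | no _    = refl

  oplus12-high : ∀ {i} → a < i → oplus12 α β i ≡ toFun β (i ∸ a) + a
  oplus12-high {i} a<i with a <? i
  ... | yes _   = refl
  ... | no a≮i = ⊥-elim (a≮i a<i)

  oplus12-no-crossing : ∀ {hi lo} → Precedes (a + b) (oplus12 α β) hi lo → lo ≤ a → a < hi → ⊥
  oplus12-no-crossing (positions {p} {q} 1≤p p<q _ π[p] π[q]) lo≤a a<hi with q ≤? a
  ... | yes q≤a = <⇒≱ (subst (a <_) (sym π[p]) a<hi)
                      (subst (_≤ a) (sym (oplus12-low p≤a)) (proj₂ (toFun-range α p 1≤p p≤a)))
    where
    p≤a = ≤-trans (<⇒≤ p<q) q≤a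
  ... | no q≰a = <⇒≱ a<π[q] (subst (_≤ a) (sym π[q]) lo≤a)
    where
    a<q = ≰⇒> q≰a
    a<π[q] : a < oplus12 α β q
    a<π[q] = subst (a <_) (sym (oplus12-high a<q))
               (+-monoˡ-≤ a (toFun-positive β (q ∸ a) (m<n⇒0<n∸m a<q)))


  oplus12-reduced-avoids : ∀ {r} → Reduced (a + b) (oplus12 α β) r → All (_≢ a) r
  oplus12-reduced-avoids {r} R with all-≢-or-split a r
  ... | inj₁ r≢a = r≢a
  ... | inj₂ (x , y , refl , x≢a) = ⊥-elim (
    oplus12-no-crossing (precedes-cong (proj₂ (proj₁ R′)) (precedes-persists (x ++ [ a ]) y R′ x[a]<x[1+a] start))
                        x[a]≤a a<x[1+a])
    where
    R′ : Reduced (a + b) (oplus12 α β) ((x ++ [ a ]) ++ y)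
    R′ = subst (Reduced (a + b) (oplus12 α β)) (sym (++-assoc x [ a ] y)) R
    a∈ = All.head (++⁻ʳ x (proj₁ (proj₁ R)))
    x[a]≤a : prod x a ≤ a
    x[a]≤a = prod-preserves-≤ x≢a ≤-refl
    a<x[1+a] : a < prod x (suc a)
    a<x[1+a] = prod-preserves-> x≢a (n<1+n a)
    x[a]<x[1+a] = ≤-<-trans x[a]≤a a<x[1+a]
    start : Precedes (a + b) (prod (x ++ [ a ])) (prod x (suc a)) (prod x a)
    start = positions (proj₁ a∈) (n<1+n a) (proj₂ a∈)
                      (trans (prod-++ x [ a ] a) (cong (prod x) (s-at-r a)))
                      (trans (prod-++ x [ a ] (suc a)) (cong (prod x) (s-at-1+r a)))

  η-isWordFor⁺ : ∀ {w} → IsWordFor a (toFun α) (unders w) → IsWordFor b (toFun β) (overs w) →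
                 IsWordFor (a + b) (oplus12 α β) (η a w)
  η-isWordFor⁺ {w} (us , u≗α) (vs , v≗β) = η-isWord ws , ηw≗π
    where
    open ≡-Reasoning
    ws = admissible⁺ us vs
    ηw≗π : Agree (a + b) (prod (η a w)) (oplus12 α β)
    ηw≗π i 1≤i i≤a+b with i ≤? a
    ... | yes i≤a = begin
      prod (η a w) i     ≡⟨ prod-η-low ws i≤a ⟩
      prod (unders w) i  ≡⟨ u≗α i 1≤i i≤a ⟩
      toFun α i          ≡⟨ sym (oplus12-low i≤a) ⟩
      oplus12 α β i      ∎
    ... | no i≰a = begin
      prod (η a w) i               ≡⟨ cong (prod (η a w)) (sym (m∸n+n≡m (<⇒≤ a<i))) ⟩
      prod (η a w) (i ∸ a + a)     ≡⟨ prod-η-high ws 1≤i∸a i∸a≤b ⟩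
      prod (overs w) (i ∸ a) + a   ≡⟨ cong (_+ a) (v≗β (i ∸ a) 1≤i∸a i∸a≤b) ⟩
      toFun β (i ∸ a) + a          ≡⟨ sym (oplus12-high a<i) ⟩
      oplus12 α β i                ∎
      where
      a<i = ≰⇒> i≰a
      1≤i∸a = m<n⇒0<n∸m a<i
      i∸a≤b = subst (i ∸ a ≤_) (m+n∸m≡n a b) (∸-monoˡ-≤ a i≤a+b)

  η-isWordFor⁻ : ∀ {w} → All (Admissible a b) w → IsWordFor (a + b) (oplus12 α β) (η a w) →
                 IsWordFor a (toFun α) (unders w) × IsWordFor b (toFun β) (overs w)
  η-isWordFor⁻ {w} ws (_ , ηw≗π) = (proj₁ (admissible⁻ ws) , u≗α) , (proj₂ (admissible⁻ ws) , v≗β)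
    where
    open ≡-Reasoning
    u≗α : Agree a (prod (unders w)) (toFun α)
    u≗α i 1≤i i≤a = begin
      prod (unders w) i  ≡⟨ sym (prod-η-low ws i≤a) ⟩
      prod (η a w) i     ≡⟨ ηw≗π i 1≤i (≤-trans i≤a (m≤m+n a b)) ⟩
      oplus12 α β i      ≡⟨ oplus12-low i≤a ⟩
      toFun α i          ∎
    v≗β : Agree b (prod (overs w)) (toFun β)
    v≗β t 1≤t t≤b = +-cancelʳ-≡ a _ _ (begin
      prod (overs w) t + a     ≡⟨ sym (prod-η-high ws 1≤t t≤b) ⟩
      prod (η a w) (t + a)     ≡⟨ ηw≗π (t + a) (≤-trans 1≤t (m≤m+n t a))
                                      (subst (t + a ≤_) (+-comm b a) (+-monoˡ-≤ a t≤b)) ⟩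
      oplus12 α β (t + a)      ≡⟨ oplus12-high (+-monoˡ-≤ a 1≤t) ⟩
      toFun β (t + a ∸ a) + a  ≡⟨ cong (λ k → toFun β k + a) (m+n∸n≡m t a) ⟩
      toFun β t + a            ∎)

  η-reduced⁻ : ∀ {w} → All (Admissible a b) w → Reduced (a + b) (oplus12 α β) (η a w) →
               Reduced a (toFun α) (unders w) × Reduced b (toFun β) (overs w)
  η-reduced⁻ {w} ws (ηw-for-π , minimal) =
    (u-for-α , λ u′ u′-for-α → +-cancelʳ-≤ _ _ _ (≤-join u′-for-α v-for-β)) ,
    (v-for-β , λ v′ v′-for-β → +-cancelˡ-≤ _ _ _ (≤-join u-for-α v′-for-β))
    where
    u-for-α = proj₁ (η-isWordFor⁻ ws ηw-for-π)
    v-for-β = proj₂ (η-isWordFor⁻ ws ηw-for-π)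
    ≤-join : ∀ {u v} → IsWordFor a (toFun α) u → IsWordFor b (toFun β) v →
             length (unders w) + length (overs w) ≤ length u + length v
    ≤-join {u} {v} u-for v-for = begin
      length (unders w) + length (overs w)                    ≡⟨ sym (length-η a w) ⟩
      length (η a w)                                          ≤⟨ minimal _ join-for-π ⟩
      length (η a (join u v))                                 ≡⟨ length-η a (join u v) ⟩
      length (unders (join u v)) + length (overs (join u v))  ≡⟨ cong₂ (λ x y → length x + length y) u≡ v≡ ⟩
      length u + length v                                     ∎
      where
      open ≤-Reasoning
      u≡ = proj₁ (unders-overs-join u v)
      v≡ = proj₂ (unders-overs-join u v)
      join-for-π = η-isWordFor⁺ {join u v} (subst (IsWordFor a (toFun α)) (sym u≡) u-for)
                                (subst (IsWordFor b (toFun β)) (sym v≡) v-for)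

  η⁻¹-reduced : ∀ {r} → Reduced (a + b) (oplus12 α β) r →
                Reduced a (toFun α) (unders (η⁻¹ a r)) × Reduced b (toFun β) (overs (η⁻¹ a r))
  η⁻¹-reduced {r} R = η-reduced⁻ (η⁻¹-admissible (proj₁ (proj₁ R)) (oplus12-reduced-avoids R))
                                 (subst (Reduced (a + b) (oplus12 α β)) (sym (η-η⁻¹ a r)) R)

  U⇒reduced : ∀ {w} → U α β w → Reduced a (toFun α) (unders w) × Reduced b (toFun β) (overs w)
  U⇒reduced (u , v , Ru , Rv , S) =
    subst (Reduced a (toFun α)) (sym (proj₁ (shuffle⇒unders-overs u v S))) Ru ,
    subst (Reduced b (toFun β)) (sym (proj₂ (shuffle⇒unders-overs u v S))) Rv

  U⇒admissible : ∀ {w} → U α β w → All (Admissible a b) w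
  U⇒admissible Uw = admissible⁺ (proj₁ (proj₁ (proj₁ (U⇒reduced Uw)))) (proj₁ (proj₁ (proj₂ (U⇒reduced Uw))))

  η⁻¹-U : ∀ {r} → Reduced (a + b) (oplus12 α β) r → U α β (η⁻¹ a r)
  η⁻¹-U {r} R = unders (η⁻¹ a r) , overs (η⁻¹ a r) , proj₁ (η⁻¹-reduced R) , proj₂ (η⁻¹-reduced R) ,
                shuffle-unders-overs (η⁻¹ a r)

  -- Minimality: a reduced word z of 12[α, β] splits into words for α and β,
  -- which are no shorter than the reduced parts of w.
  η-reduced : ∀ {w} → U α β w → Reduced (a + b) (oplus12 α β) (η a w)
  η-reduced {w} Uw = η-isWordFor⁺ (proj₁ Ru) (proj₁ Rv) , minimal
    where
    Ru = proj₁ (U⇒reduced Uw)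
    Rv = proj₂ (U⇒reduced Uw)
    minimal : ∀ w′ → IsWordFor (a + b) (oplus12 α β) w′ → length (η a w) ≤ length w′
    minimal w′ w′-for-π = begin
      length (η a w)                              ≡⟨ length-η a w ⟩
      length (unders w) + length (overs w)        ≤⟨ +-mono-≤ (proj₂ Ru _ (proj₁ (proj₁ z-parts)))
                                                              (proj₂ Rv _ (proj₁ (proj₂ z-parts))) ⟩
      length (unders z′) + length (overs z′)      ≡⟨ sym (length-η a z′) ⟩
      length (η a z′)                             ≡⟨ cong length (η-η⁻¹ a z) ⟩
      length z                                    ≤⟨ proj₂ Rz w′ w′-for-π ⟩
      length w′                                   ∎
      where
      open ≤-Reasoning
      z = proj₁ (reduced-exists w′-for-π)
      Rz = proj₂ (reduced-exists w′-for-π)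
      z′ = η⁻¹ a z
      z-parts = η⁻¹-reduced Rz

  η-graphIso : GraphIso (U α β) LetterAdj (Reduced (a + b) (oplus12 α β)) NatAdj
  η-graphIso = record
    { to      = λ { (w , Uw) → η a w , η-reduced Uw }
    ; from    = λ { (r , R) → η⁻¹ a r , η⁻¹-U R }
    ; from∘to = λ { (w , Uw) → η⁻¹-η (U⇒admissible Uw) }
    ; to∘from = λ { (r , R) → η-η⁻¹ a r }
    ; adj⇒    = λ { (w , Uw) _ → η-step (U⇒admissible Uw) }
    ; adj⇐    = λ { (w , Uw) (w′ , Uw′) → η-step⁻¹ (U⇒admissible Uw) (U⇒admissible Uw′) }
    }

theorem3p4 : (a b : ℕ) (α : Permutation′ a) (β : Permutation′ b) →
    -- η maps U_{α,β} into R(π), π = 12[α,β]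
    ((w : List Letter) → U α β w → Reduced (a + b) (oplus12 α β) (η a w))
    -- η is injective on U_{α,β}
    × ((w w′ : List Letter) → U α β w → U α β w′ → η a w ≡ η a w′ → w ≡ w′)
    -- η is onto R(π)
    × ((r : List ℕ) → Reduced (a + b) (oplus12 α β) r →
         Σ (List Letter) λ w → U α β w × η a w ≡ r)
    -- G_{α,β} ≅ G_π
    × GraphIso (U α β) LetterAdj (Reduced (a + b) (oplus12 α β)) NatAdj
theorem3p4 a b α β =
  (λ _ → η-reduced α β) ,
  (λ _ _ Uw Uw′ → η-injective (U⇒admissible α β Uw) (U⇒admissible α β Uw′)) ,
  (λ r R → η⁻¹ a r , η⁻¹-U α β R , η-η⁻¹ a r) ,
  η-graphIso α β
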